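{- If there exists an $r$-uniform critical hypergraph $H$, then there exists an $(r+1)$-uniform critical hypergraph with $|V(H)|+r+1$ vertices and at most $(r+1)\cdot|E(H)|+1$ edges.
   Context: A hypergraph is $r$-uniform if all edges have exactly $r$ vertices; it is intersecting if any two edges intersect; its cover number is the minimum size of a vertex set meeting every edge. An $r$-uniform hypergraph is called critical if it is intersecting and has cover number equal to $r$. -}

module Defs where

open import Data.Nat using (ℕ; _≤_)
open import Data.Fin.Subset using (Subset; _∩_; Nonempty; ∣_∣)
open import Data.List using (List)
open import Data.List.Membership.Propositional using (_∈_)
open import Data.List.Relation.Unary.All using (All)
open import Data.List.Relation.Unary.Unique.Propositional using (Unique)
open import Data.Product using (Σ; _×_)
open import Relation.Binary.PropositionalEquality using (_≡_)

-- A finite hypergraph on vertex set Fin nV; the edge set is a duplicate-free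
-- list of subsets of the vertex set (so |E(H)| = length edges).
record Hypergraph : Set where
  field
    nV       : ℕ
    edges    : List (Subset nV)
    distinct : Unique edges
open Hypergraph public

Uniform : ℕ → Hypergraph → Set
Uniform r H = All (λ e → ∣ e ∣ ≡ r) (edges H)

Intersecting : Hypergraph → Set
Intersecting H = ∀ {e f} → e ∈ edges H → f ∈ edges H → Nonempty (e ∩ f)

IsCover : (H : Hypergraph) → Subset (nV H) → Set
IsCover H C = All (λ e → Nonempty (e ∩ C)) (edges H)

CoverNumber : Hypergraph → ℕ → Set
CoverNumber H k =
  Σ (Subset (nV H)) (λ C → IsCover H C × ∣ C ∣ ≡ k)
  × (∀ (C : Subset (nV H)) → IsCover H C → k ≤ ∣ C ∣)

Critical : ℕ → Hypergraph → Set
Critical r H = Uniform r H × Intersecting H × CoverNumber H r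

{-# OPTIONS --safe #-}
-- Add r + 1 new vertices Y, and take as edges Y itself together with e ∪ {y}
-- for every edge e of H and every y ∈ Y.  Any two such edges meet (in H or in
-- Y), and C ∪ {y} is a cover of size r + 1 whenever C is a minimum cover of H.
-- Conversely a cover either contains all of Y, or misses some y ∈ Y; then its
-- trace on V(H) must cover H (through the edges e ∪ {y}) and it must still
-- meet Y, so it has at least r + 1 vertices.
module Submission where

open import Defs
open import Data.Nat using (ℕ; suc; _+_; _*_; _≤_)
open import Data.List using (length)
open import Data.Product using (Σ; _×_)
open import Relation.Binary.PropositionalEquality using (_≡_)

open import Data.Bool using (_∧_)
open import Data.Nat using (s≤s; z≤n)
open import Data.Empty using (⊥-elim)
open import Data.Fin using (Fin; zero; suc)
open import Data.Fin.Properties using (any?)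
open import Data.Fin.Subset
  using (Subset; _∩_; Nonempty; ∣_∣; ⊥; ⊤; ⁅_⁆; _∈_; _∉_; _⊆_; inside; outside)
open import Data.Fin.Subset.Properties
  using ( x∈p∩q⁺; p∩q⊆p; p∩q⊆q; x∈⁅x⁆; x∈⁅y⁆⇒x≡y; ∉⊥; ∈⊤; _∈?_
        ; ∣⊥∣≡0; ∣⊤∣≡n; ∣⁅x⁆∣≡1; ∣p∣≤∣x∷p∣; p⊆q⇒∣p∣≤∣q∣)
open import Data.List using (List; []; _∷_; map; allFin; cartesianProductWith)
  renaming (_++_ to _++ₗ_)
open import Data.List.Properties using (length-++; length-map; length-tabulate)
open import Data.List.Membership.Propositional using () renaming (_∈_ to _∈ₗ_)
open import Data.List.Membership.Propositional.Properties
  using (∈-cartesianProductWith⁺; ∈-cartesianProductWith⁻; ∈-allFin)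
open import Data.List.Relation.Unary.All as All using (All)
open import Data.List.Relation.Unary.Any as Any using ()
open import Data.List.Relation.Unary.AllPairs using (_∷_)
open import Data.List.Relation.Unary.Unique.Propositional.Properties
  using (cartesianProductWith⁺; allFin⁺)
open import Data.Nat.Properties
  using (+-comm; *-comm; ≤-refl; ≤-reflexive; ≤-trans; +-mono-≤; m≤n+m; module ≤-Reasoning)
open import Data.Product as Product using (_,_; ∃; map₂)
open import Data.Sum as Sum using (_⊎_; inj₁; inj₂; [_,_]′)
open import Data.Vec using ([]; _∷_; _++_; here; there; splitAt)
open import Data.Vec.Properties using (++-injective; zipWith-++)
open import Function using (id; _∘_)
open import Relation.Nullary using (¬_; ¬?; yes; no; Dec)
open import Relation.Nullary.Decidable using (decidable-stable)
open import Relation.Binary.PropositionalEquality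
  using (refl; sym; trans; cong; cong₂; subst; _≢_; module ≡-Reasoning)

∣p++q∣≡∣p∣+∣q∣ : ∀ {m n} (p : Subset m) (q : Subset n) → ∣ p ++ q ∣ ≡ ∣ p ∣ + ∣ q ∣
∣p++q∣≡∣p∣+∣q∣ []            q = refl
∣p++q∣≡∣p∣+∣q∣ (inside  ∷ p) q = cong suc (∣p++q∣≡∣p∣+∣q∣ p q)
∣p++q∣≡∣p∣+∣q∣ (outside ∷ p) q = ∣p++q∣≡∣p∣+∣q∣ p q

Nonempty⇒1≤∣p∣ : ∀ {n} {p : Subset n} → Nonempty p → 1 ≤ ∣ p ∣
Nonempty⇒1≤∣p∣ (zero , here) = s≤s z≤n
Nonempty⇒1≤∣p∣ {p = s ∷ p} (suc x , there x∈p) =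
  ≤-trans (Nonempty⇒1≤∣p∣ {p = p} (x , x∈p)) (∣p∣≤∣x∷p∣ s p)

⊤⊆p⇒n≤∣p∣ : ∀ {n} {p : Subset n} → ⊤ ⊆ p → n ≤ ∣ p ∣
⊤⊆p⇒n≤∣p∣ {n} {p} ⊤⊆p = subst (_≤ ∣ p ∣) (∣⊤∣≡n n) (p⊆q⇒∣p∣≤∣q∣ ⊤⊆p)

Nonempty-++⁺ˡ : ∀ {m n} {p : Subset m} {q : Subset n} → Nonempty p → Nonempty (p ++ q)
Nonempty-++⁺ˡ (zero  , here)      = zero , here
Nonempty-++⁺ˡ (suc x , there x∈p) = Product.map suc there (Nonempty-++⁺ˡ (x , x∈p))

Nonempty-++⁺ʳ : ∀ {m n} (p : Subset m) {q : Subset n} → Nonempty q → Nonempty (p ++ q)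
Nonempty-++⁺ʳ []      q≠∅ = q≠∅
Nonempty-++⁺ʳ (_ ∷ p) q≠∅ = Product.map suc there (Nonempty-++⁺ʳ p q≠∅)

Nonempty-++⁻ : ∀ {m n} (p : Subset m) {q : Subset n} →
               Nonempty (p ++ q) → Nonempty p ⊎ Nonempty q
Nonempty-++⁻ []      p++q≠∅              = inj₂ p++q≠∅
Nonempty-++⁻ (_ ∷ p) (zero  , here)      = inj₁ (zero , here)
Nonempty-++⁻ (_ ∷ p) (suc x , there x∈) =
  Sum.map₁ (Product.map suc there) (Nonempty-++⁻ p (x , x∈))

∈⇒meets : ∀ {n} {x : Fin n} {p q : Subset n} → x ∈ p → x ∈ q → Nonempty (p ∩ q)
∈⇒meets x∈p x∈q = _ , x∈p∩q⁺ (x∈p , x∈q)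

⁅x⁆-meets⇒x∈p : ∀ {n} {x : Fin n} (p : Subset n) → Nonempty (⁅ x ⁆ ∩ p) → x ∈ p
⁅x⁆-meets⇒x∈p {x = x} p (y , y∈⁅x⁆∩p) =
  subst (_∈ p) (x∈⁅y⁆⇒x≡y x (p∩q⊆p _ p y∈⁅x⁆∩p)) (p∩q⊆q _ p y∈⁅x⁆∩p)

module _ {m n} (p p′ : Subset m) (q q′ : Subset n) where

  private
    ∩-++ : (p ++ q) ∩ (p′ ++ q′) ≡ (p ∩ p′) ++ (q ∩ q′)
    ∩-++ = zipWith-++ _∧_ p q p′ q′

  ++-meets⁺ˡ : Nonempty (p ∩ p′) → Nonempty ((p ++ q) ∩ (p′ ++ q′))
  ++-meets⁺ˡ = subst Nonempty (sym ∩-++) ∘ Nonempty-++⁺ˡ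

  ++-meets⁺ʳ : Nonempty (q ∩ q′) → Nonempty ((p ++ q) ∩ (p′ ++ q′))
  ++-meets⁺ʳ = subst Nonempty (sym ∩-++) ∘ Nonempty-++⁺ʳ (p ∩ p′)

  ++-meets⁻ : Nonempty ((p ++ q) ∩ (p′ ++ q′)) → Nonempty (p ∩ p′) ⊎ Nonempty (q ∩ q′)
  ++-meets⁻ = Nonempty-++⁻ (p ∩ p′) ∘ subst Nonempty ∩-++

length-cartesianProductWith : ∀ {A B C : Set} (f : A → B → C) xs ys →
  length (cartesianProductWith f xs ys) ≡ length xs * length ys
length-cartesianProductWith f []       ys = refl
length-cartesianProductWith f (x ∷ xs) ys = begin
  length (map (f x) ys ++ₗ cartesianProductWith f xs ys)
    ≡⟨ length-++ (map (f x) ys) ⟩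
  length (map (f x) ys) + length (cartesianProductWith f xs ys)
    ≡⟨ cong₂ _+_ (length-map (f x) ys) (length-cartesianProductWith f xs ys) ⟩
  length ys + length xs * length ys ∎
  where open ≡-Reasoning

Intersecting⇒edges-nonempty : ∀ {H} → Intersecting H → All Nonempty (edges H)
Intersecting⇒edges-nonempty I = All.tabulate λ e∈ → map₂ (p∩q⊆p _ _) (I e∈ e∈)

-- Edges must be nonempty only to keep Y distinct from the edges e ∪ {y}:
-- for k = 0 and e = ∅ the two coincide.
module Augment (k : ℕ) (H : Hypergraph) (edges-nonempty : All Nonempty (edges H)) where

  private
    n = nV H

  Y : Subset (n + suc k)
  Y = ⊥ {n} ++ ⊤

  extend : Subset n → Fin (suc k) → Subset (n + suc k)
  extend e y = e ++ ⁅ y ⁆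

  ∣extend∣ : ∀ e y → ∣ extend e y ∣ ≡ suc ∣ e ∣
  ∣extend∣ e y = begin
    ∣ e ++ ⁅ y ⁆ ∣      ≡⟨ ∣p++q∣≡∣p∣+∣q∣ e ⁅ y ⁆ ⟩
    ∣ e ∣ + ∣ ⁅ y ⁆ ∣   ≡⟨ cong (∣ e ∣ +_) (∣⁅x⁆∣≡1 y) ⟩
    ∣ e ∣ + 1           ≡⟨ +-comm ∣ e ∣ 1 ⟩
    suc ∣ e ∣           ∎
    where open ≡-Reasoning

  extend-injective : ∀ {e f y z} → extend e y ≡ extend f z → e ≡ f × y ≡ z
  extend-injective {e} {f} {y} eq =
    let e≡f , ⁅y⁆≡⁅z⁆ = ++-injective e f eq
    in  e≡f , x∈⁅y⁆⇒x≡y _ (subst (y ∈_) ⁅y⁆≡⁅z⁆ (x∈⁅x⁆ y))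

  extended-edges : List (Subset (n + suc k))
  extended-edges = cartesianProductWith extend (edges H) (allFin (suc k))

  extended-elim : (P : Subset (n + suc k) → Set) →
                (∀ {e} → e ∈ₗ edges H → ∀ y → P (extend e y)) →
                ∀ {v} → v ∈ₗ extended-edges → P v
  extended-elim P P-extend v∈
    with ∈-cartesianProductWith⁻ extend (edges H) (allFin (suc k)) v∈
  ... | _ , y , e∈ , _ , refl = P-extend e∈ y

  Y≢extended : All (Y ≢_) extended-edges
  Y≢extended = All.tabulate (extended-elim (Y ≢_) Y≢extend)
    where
      Y≢extend : ∀ {e} → e ∈ₗ edges H → ∀ y → Y ≢ extend e y
      Y≢extend e∈ y Y≡ =
        let x , x∈e = All.lookup edges-nonempty e∈
        in  ∉⊥ (subst (x ∈_) (sym (Product.proj₁ (++-injective ⊥ _ Y≡))) x∈e)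

  augment : Hypergraph
  augment = record
    { nV       = n + suc k
    ; edges    = Y ∷ extended-edges
    ; distinct = Y≢extended ∷
                 cartesianProductWith⁺ extend extend-injective (distinct H) (allFin⁺ (suc k))
    }

  augment-elim : (P : Subset (n + suc k) → Set) → P Y →
                 (∀ {e} → e ∈ₗ edges H → ∀ y → P (extend e y)) →
                 ∀ {v} → v ∈ₗ edges augment → P v
  augment-elim P P-Y P-extend (Any.here refl) = P-Y
  augment-elim P P-Y P-extend (Any.there v∈)  = extended-elim P P-extend v∈

  augment-All : (P : Subset (n + suc k) → Set) → P Y →
                (∀ {e} → e ∈ₗ edges H → ∀ y → P (extend e y)) →
                All P (edges augment)
  augment-All P P-Y P-extend = All.tabulate (augment-elim P P-Y P-extend)

  extend∈augment : ∀ {e} → e ∈ₗ edges H → ∀ y → extend e y ∈ₗ edges augment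
  extend∈augment e∈ y = Any.there (∈-cartesianProductWith⁺ extend e∈ (∈-allFin y))

  augment-size : length (edges augment) ≡ suc k * length (edges H) + 1
  augment-size = begin
    suc (length extended-edges)
      ≡⟨ cong suc (length-cartesianProductWith extend (edges H) (allFin (suc k))) ⟩
    suc (length (edges H) * length (allFin (suc k)))
      ≡⟨ cong (λ m → suc (length (edges H) * m)) (length-tabulate id) ⟩
    suc (length (edges H) * suc k)
      ≡⟨ cong suc (*-comm (length (edges H)) (suc k)) ⟩
    suc (suc k * length (edges H))
      ≡⟨ +-comm 1 (suc k * length (edges H)) ⟩
    suc k * length (edges H) + 1 ∎
    where open ≡-Reasoning

  augment-uniform : Uniform k H → Uniform (suc k) augment
  augment-uniform U = augment-All (λ v → ∣ v ∣ ≡ suc k) ∣Y∣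
    (λ {e} e∈ y → trans (∣extend∣ e y) (cong suc (All.lookup U e∈)))
    where
      ∣Y∣ : ∣ Y ∣ ≡ suc k
      ∣Y∣ = trans (∣p++q∣≡∣p∣+∣q∣ (⊥ {n}) ⊤) (cong₂ _+_ (∣⊥∣≡0 n) (∣⊤∣≡n (suc k)))

  augment-intersecting : Intersecting H → Intersecting augment
  augment-intersecting I {v} {w} v∈ w∈ =
    augment-elim (λ v → Nonempty (v ∩ w)) (Y-meets w∈) (λ e∈ y → extend-meets e∈ y w∈) v∈
    where
      Y-meets : ∀ {w} → w ∈ₗ edges augment → Nonempty (Y ∩ w)
      Y-meets = augment-elim (λ w → Nonempty (Y ∩ w))
        (++-meets⁺ʳ ⊥ ⊥ ⊤ ⊤ (∈⇒meets (∈⊤ {x = zero}) ∈⊤))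
        (λ {f} _ z → ++-meets⁺ʳ ⊥ f ⊤ ⁅ z ⁆ (∈⇒meets ∈⊤ (x∈⁅x⁆ z)))

      extend-meets : ∀ {e} → e ∈ₗ edges H → ∀ y {w} → w ∈ₗ edges augment →
                     Nonempty (extend e y ∩ w)
      extend-meets {e} e∈ y = augment-elim (λ w → Nonempty (extend e y ∩ w))
        (++-meets⁺ʳ e ⊥ ⁅ y ⁆ ⊤ (∈⇒meets (x∈⁅x⁆ y) ∈⊤))
        (λ {f} f∈ z → ++-meets⁺ˡ e f ⁅ y ⁆ ⁅ z ⁆ (I e∈ f∈))

  augment-cover : ∀ {C} → IsCover H C → ∀ y → IsCover augment (extend C y)
  augment-cover {C} cov y = augment-All (λ v → Nonempty (v ∩ extend C y))
    (++-meets⁺ʳ ⊥ C ⊤ ⁅ y ⁆ (∈⇒meets ∈⊤ (x∈⁅x⁆ y)))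
    (λ {e} e∈ z → ++-meets⁺ˡ e C ⁅ z ⁆ ⁅ y ⁆ (All.lookup cov e∈))

  module _ (C₁ : Subset n) (C₂ : Subset (suc k)) (cov : IsCover augment (C₁ ++ C₂)) where

    cover-meets-Y : Nonempty C₂
    cover-meets-Y = [ ⊥-elim ∘ ⊥∩C₁-empty , map₂ (p∩q⊆q ⊤ C₂) ]′
      (++-meets⁻ ⊥ C₁ ⊤ C₂ (All.head cov))
      where
        ⊥∩C₁-empty : ¬ Nonempty (⊥ ∩ C₁)
        ⊥∩C₁-empty (_ , x∈) = ∉⊥ (p∩q⊆p ⊥ C₁ x∈)

    cover-restricts : ∀ {y} → y ∉ C₂ → IsCover H C₁
    cover-restricts {y} y∉C₂ = All.tabulate λ {e} e∈ →
      [ id , ⊥-elim ∘ y∉C₂ ∘ ⁅x⁆-meets⇒x∈p C₂ ]′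
        (++-meets⁻ e C₁ ⁅ y ⁆ C₂ (All.lookup cov (extend∈augment e∈ y)))

  augment-cover-lower-bound : ∀ {r} → (∀ C → IsCover H C → r ≤ ∣ C ∣) → r ≤ k →
                              ∀ C → IsCover augment C → suc r ≤ ∣ C ∣
  augment-cover-lower-bound {r} min r≤k C cov with splitAt n C
  ... | C₁ , C₂ , refl =
    subst (suc r ≤_) (sym (∣p++q∣≡∣p∣+∣q∣ C₁ C₂)) (bound (any? λ y → ¬? (y ∈? C₂)))
    where
      open ≤-Reasoning
      bound : Dec (∃ (_∉ C₂)) → suc r ≤ ∣ C₁ ∣ + ∣ C₂ ∣
      bound (yes (_ , y∉C₂)) = begin
        suc r           ≡⟨ +-comm 1 r ⟩
        r + 1           ≤⟨ +-mono-≤ (min C₁ (cover-restricts C₁ C₂ cov y∉C₂))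
                                    (Nonempty⇒1≤∣p∣ (cover-meets-Y C₁ C₂ cov)) ⟩
        ∣ C₁ ∣ + ∣ C₂ ∣ ∎
      bound (no ∄y∉C₂) = begin
        suc r           ≤⟨ s≤s r≤k ⟩
        suc k           ≤⟨ ⊤⊆p⇒n≤∣p∣ (λ {y} _ → decidable-stable (y ∈? C₂) (∄y∉C₂ ∘ (y ,_))) ⟩
        ∣ C₂ ∣          ≤⟨ m≤n+m ∣ C₂ ∣ ∣ C₁ ∣ ⟩
        ∣ C₁ ∣ + ∣ C₂ ∣ ∎

  augment-critical : Critical k H → Critical (suc k) augment
  augment-critical (U , I , (C , cov , ∣C∣≡k) , min) =
    augment-uniform U ,
    augment-intersecting I ,
    (extend C zero , augment-cover cov zero , trans (∣extend∣ C zero) (cong suc ∣C∣≡k)) ,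
    augment-cover-lower-bound min ≤-refl

lemma3p3 : (r : ℕ) (H : Hypergraph) → Critical r H →
    Σ Hypergraph (λ H′ → Critical (suc r) H′
      × nV H′ ≡ nV H + suc r
      × length (edges H′) ≤ suc r * length (edges H) + 1)
lemma3p3 r H crit@(_ , I , _) =
  augment , augment-critical crit , refl , ≤-reflexive augment-size
  where open Augment r H (Intersecting⇒edges-nonempty {H} I)
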